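{- Let $k\ge 1$ and $n\ge 1$ be integers. Then the rational number $(n-1)^{\underline{k}}/(k+1)$ is an integer unless (i) $k+1=4$ and $4\mid n$, or (ii) $k+1$ is a prime $p$ and $p\mid n$. Moreover, for every prime $p$, $\nu_p\big((n-1)^{\underline{k}}/(k+1)\big)\ge -1$, and $\nu_p\big((n-1)^{\underline{k}}/(k+1)\big)\ge 0$ if $(k+1)\nmid n$.
   Context: For integers $m$ and $k\ge 1$, the falling factorial is $m^{\underline{k}}=m(m-1)\cdots(m-k+1)$ (it is $0$ when $0\le m<k$). For a prime $p$ and a nonzero integer $m$, $\nu_p(m)$ is the exponent of the largest power of $p$ dividing $m$; it extends to nonzero rationals by $\nu_p(r/s)=\nu_p(r)-\nu_p(s)$, and (standard convention) $\nu_p(0)=+\infty$. -}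

module Defs where

open import Data.Nat using (ℕ; zero; suc; _*_; _∸_; _^_)
open import Data.Nat.Divisibility using (_∣_)
open import Data.Product using (_×_)
open import Relation.Nullary using (¬_)
open import Data.Integer as ℤ using (ℤ; +_; _-_)

-- falling factorial m^{\underline k} = m (m-1) ... (m-k+1)  (m^{\underline 0} = 1)
-- (for natural m; truncated subtraction is harmless since the factor 0 occurs first)
ff : ℕ → ℕ → ℕ
ff m zero    = 1
ff m (suc k) = m * ff (m ∸ 1) k

-- IsVal p m v : v = ν_p(m), i.e. p^v is the largest power of p dividing m.
-- For m = 0 no v satisfies this (ν_p(0) = +∞).
IsVal : ℕ → ℕ → ℕ → Set
IsVal p m v = (p ^ v ∣ m) × ¬ (p ^ suc v ∣ m)

-- ν_p(a / b) ≥ c for naturals a, b (b ≠ 0), c ∈ ℤ, via ν_p(a/b) = ν_p(a) - ν_p(b).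
-- If a = 0 then ν_p(a/b) = +∞ and this holds vacuously.
ValGe : ℕ → ℕ → ℕ → ℤ → Set
ValGe p a b c = ∀ va vb → IsVal p a va → IsVal p b vb → c ℤ.≤ (+ va) - (+ vb)

{-# OPTIONS --safe #-}
module Submission where

-- Write c = k + 1 and a = (n-1)(n-2)⋯(n-k). If c ∤ n, the residue of n modulo c lies in
-- [1, k], so c divides one of the k factors of a. Every product of k consecutive integers
-- is divisible by k!, and a composite c ≠ 4 divides (c - 1)! = k!; hence c ∣ a except when
-- c = 4 or c is prime and c ∣ n. In those cases ν_p(c) ≤ 1, except ν_2(4) = 2, which is
-- compensated by 2 ∣ 3! ∣ a; this gives ν_p(a / c) ≥ -1 for every prime p.

open import Defs
open import Data.Nat as ℕ
  using (ℕ; zero; suc; _+_; _*_; _∸_; _^_; _≤_; _<_; _!; pred; NonZero; z≤n; s≤s; z<s)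
open import Data.Nat.Properties
open import Data.Nat.Divisibility
open import Data.Nat.DivMod using (_%_; m%n<n; m≡m%n+[m/n]*n) renaming (_/_ to _div_)
open import Data.Nat.Combinatorics using ([n∸k]!k!∣n!)
open import Data.Nat.Primality
open import Data.Integer as ℤ using (+_; -[1+_]; _-_; -_)
import Data.Integer.Properties as ℤ
open import Data.Rational using (_/_)
import Data.Rational.Properties as ℚ
import Data.Rational.Unnormalised as ℚᵘ
open import Data.Product using (_×_; ∃-syntax; _,_)
open import Data.Sum using (inj₁; inj₂)
open import Relation.Binary.Definitions using (Tri; tri<; tri≈; tri>)
open import Relation.Nullary using (¬_; yes; no; contradiction)
open import Relation.Binary.PropositionalEquality using (_≡_; _≢_; refl; sym; trans; cong; cong₂; subst; module ≡-Reasoning)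

private
  variable
    p a b i j k m n : ℕ

ff-*-! : k ≤ m → ff m k * (m ∸ k) ! ≡ m !
ff-*-! {zero}  {m}     _         = *-identityˡ (m !)
ff-*-! {suc k} {suc m} (s≤s k≤m) = begin
  suc m * ff m k * (m ∸ k) !   ≡⟨ *-assoc (suc m) (ff m k) ((m ∸ k) !) ⟩
  suc m * (ff m k * (m ∸ k) !) ≡⟨ cong (suc m *_) (ff-*-! k≤m) ⟩
  suc m * m !                  ∎
  where open ≡-Reasoning

ff-≡0 : m < k → ff m k ≡ 0
ff-≡0 {zero}  {suc k} _         = refl
ff-≡0 {suc m} {suc k} (s≤s m<k) = trans (cong (suc m *_) (ff-≡0 m<k)) (*-zeroʳ (suc m))

!∣ff : ∀ m k → k ! ∣ ff m k
!∣ff m k with k ≤? m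
... | yes k≤m = *-cancelˡ-∣ ((m ∸ k) !) {{(m ∸ k) !≢0}} (begin
  (m ∸ k) ! * k !     ∣⟨ [n∸k]!k!∣n! k≤m ⟩
  m !                 ≡⟨ ff-*-! k≤m ⟨
  ff m k * (m ∸ k) !  ≡⟨ *-comm (ff m k) ((m ∸ k) !) ⟩
  (m ∸ k) ! * ff m k  ∎)
  where open ∣-Reasoning
... | no  k≰m = subst (k ! ∣_) (sym (ff-≡0 (≰⇒> k≰m))) ((k !) ∣0)

∸∣ff : ∀ m {i k} → i < k → m ∸ i ∣ ff m k
∸∣ff zero    {k = suc k} _             = _ ∣0
∸∣ff (suc m) {zero}  {suc k} _         = m∣m*n (ff m k)
∸∣ff (suc m) {suc i} {suc k} (s≤s i<k) = ∣n⇒∣m*n (suc m) (∸∣ff m i<k)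

-- The residue r of n modulo k + 1 lies in [1, k], and n - r is one of the factors of ff (n - 1) k.
suc∣ff-pred : ∀ n → ¬ (suc k ∣ n) → suc k ∣ ff (n ∸ 1) k
suc∣ff-pred {k} n k+1∤n with n % suc k in n%≡ | m%n<n n (suc k)
... | zero  | _       = contradiction (m%n≡0⇒n∣m n (suc k) n%≡) k+1∤n
... | suc r | s≤s r<k = ∣-trans (divides (n div suc k) n-1-r≡) (∸∣ff (n ∸ 1) r<k)
  where
  open ≡-Reasoning
  n-1-r≡ : n ∸ 1 ∸ r ≡ n div suc k * suc k
  n-1-r≡ = begin
    n ∸ 1 ∸ r                                ≡⟨ ∸-+-assoc n 1 r ⟩
    n ∸ suc r                                ≡⟨ cong (_∸ suc r) (m≡m%n+[m/n]*n n (suc k)) ⟩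
    n % suc k + n div suc k * suc k ∸ suc r  ≡⟨ cong (λ x → x + n div suc k * suc k ∸ suc r) n%≡ ⟩
    suc r + n div suc k * suc k ∸ suc r      ≡⟨ m+n∸m≡n (suc r) _ ⟩
    n div suc k * suc k                      ∎

∣! : 0 < i → i ≤ m → i ∣ m !
∣! {suc i} _ i+1≤m = ∣-trans (m∣m*n (i !)) (m≤n⇒m!∣n! i+1≤m)

*∣! : 0 < i → i < j → j ≤ m → i * j ∣ m !
*∣! {i} {suc j} {m} 0<i (s≤s i≤j) j+1≤m = begin
  i * suc j     ≡⟨ *-comm i (suc j) ⟩
  suc j * i     ∣⟨ *-monoʳ-∣ (suc j) (∣! 0<i i≤j) ⟩
  suc j * j !   ∣⟨ m≤n⇒m!∣n! j+1≤m ⟩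
  m !           ∎
  where open ∣-Reasoning

-- i and 2i are distinct and below i², and i * i divides i * (2 * i).
square∣pred! : 2 < i → i * i ∣ pred (i * i) !
square∣pred! {i} 2<i = ∣-trans (*-monoʳ-∣ i (n∣m*n 2)) (*∣! (<-trans (s≤s z≤n) 2<i) i<2i 2i≤pred[i²])
  where
  instance _ = ℕ.>-nonZero (<-trans (s≤s z≤n) 2<i)
  i<2i : i < 2 * i
  i<2i = subst (i <_) (*-comm i 2) (m<m*n i 2 (s≤s (s≤s z≤n)))
  2i≤pred[i²] : 2 * i ≤ pred (i * i)
  2i≤pred[i²] = <⇒≤pred (subst (_< i * i) (*-comm i 2) (*-monoʳ-< i 2<i))

composite⇒∣pred! : Composite n → n ≢ 4 → n ∣ pred n !
composite⇒∣pred! (composite {d} d<ed (divides e refl)) ed≢4 = distinct-or-equal (<-cmp e d)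
  where
  1<d : 1 < d
  1<d = ℕ.nonTrivial⇒n>1 d
  0<e : 0 < e
  0<e = n≢0⇒n>0 λ e≡0 → n≮0 (subst (λ x → d < x * d) e≡0 d<ed)
  e<ed : e < e * d
  e<ed = m<m*n e d {{ℕ.>-nonZero 0<e}} 1<d
  distinct-or-equal : Tri (e < d) (e ≡ d) (d < e) → e * d ∣ pred (e * d) !
  distinct-or-equal (tri< e<d _ _) = *∣! 0<e e<d (<⇒≤pred d<ed)
  distinct-or-equal (tri> _ _ d<e) =
    subst (_∣ pred (e * d) !) (*-comm d e) (*∣! (<-trans z<s 1<d) d<e (<⇒≤pred e<ed))
  distinct-or-equal (tri≈ _ e≡d _) =
    subst (λ x → x * d ∣ pred (x * d) !) (sym e≡d) (square∣pred! 2<d)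
    where
    2<d : 2 < d
    2<d = ≤∧≢⇒< 1<d λ 2≡d → ed≢4 (cong₂ _*_ (trans e≡d (sym 2≡d)) (sym 2≡d))

¬prime⇒∣! : ¬ Prime (suc k) → suc k ≢ 4 → suc k ∣ k !
¬prime⇒∣! {zero}  _          _     = ∣-refl
¬prime⇒∣! {suc k} k+2-¬prime k+2≢4 = composite⇒∣pred! (¬prime⇒composite k+2-¬prime) k+2≢4

^-monoʳ-∣ : ∀ p {i j} → i ≤ j → p ^ i ∣ p ^ j
^-monoʳ-∣ p {zero}          _         = 1∣ _
^-monoʳ-∣ p {suc i} {suc j} (s≤s i≤j) = *-monoʳ-∣ p (^-monoʳ-∣ p i≤j)

isVal-maximal : IsVal p a i → p ^ j ∣ a → j ≤ i
isVal-maximal {p} {i = i} {j} (_ , p^[1+i]∤a) p^j∣a with j ≤? i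
... | yes j≤i = j≤i
... | no  j≰i = contradiction (∣-trans (^-monoʳ-∣ p (≰⇒> j≰i)) p^j∣a) p^[1+i]∤a

n∸o≤m⇒-o≤m-n : ∀ {m n o} → n ∸ o ≤ m → - + o ℤ.≤ + m - + n
n∸o≤m⇒-o≤m-n {m} {n} {o} n∸o≤m rewrite ℤ.m-n≡m⊖n m n with ≤-total n m
... | inj₁ n≤m rewrite ℤ.⊖-≥ n≤m = ℤ.neg-≤-pos
... | inj₂ m≤n rewrite ℤ.⊖-≤ m≤n = ℤ.neg-mono-≤ (ℤ.+≤+ (m≤n+o⇒m∸n≤o n m n≤m+o))
  where
  n≤m+o : n ≤ m + o
  n≤m+o = ≤-trans (m≤n+m∸n n o) (≤-trans (+-monoʳ-≤ o n∸o≤m) (≤-reflexive (+-comm o m)))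

powers⇒valGe : ∀ e → (∀ v → p ^ v ∣ b → p ^ (v ∸ e) ∣ a) → ValGe p a b (- + e)
powers⇒valGe e h va vb va-val (p^vb∣b , _) = n∸o≤m⇒-o≤m-n (isVal-maximal va-val (h vb p^vb∣b))

∣⇒valGe0 : b ∣ a → ValGe p a b (+ 0)
∣⇒valGe0 b∣a = powers⇒valGe 0 λ _ p^v∣b → ∣-trans p^v∣b b∣a

∣*⇒valGe-1 : .{{NonZero p}} → b ∣ p * a → ValGe p a b -[1+ 0 ]
∣*⇒valGe-1 {p} {b} {a} b∣pa = powers⇒valGe 1 divide-out
  where
  divide-out : ∀ v → p ^ v ∣ b → p ^ (v ∸ 1) ∣ a
  divide-out zero    _       = 1∣ a
  divide-out (suc v) p^v+1∣b = *-cancelˡ-∣ p (∣-trans p^v+1∣b b∣pa)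

¬^2∣⇒valGe-1 : ¬ (p ^ 2 ∣ b) → ValGe p a b -[1+ 0 ]
¬^2∣⇒valGe-1 {p} {b} {a} p²∤b = powers⇒valGe 1 at-most-one
  where
  at-most-one : ∀ v → p ^ v ∣ b → p ^ (v ∸ 1) ∣ a
  at-most-one zero          _       = 1∣ a
  at-most-one (suc zero)    _       = 1∣ a
  at-most-one (suc (suc v)) p^v+2∣b =
    contradiction (∣-trans (^-monoʳ-∣ p {2} {2 + v} (s≤s (s≤s z≤n))) p^v+2∣b) p²∤b

prime∣prime⇒≡ : Prime p → Prime m → p ∣ m → p ≡ m
prime∣prime⇒≡ p-prime m-prime p∣m with prime⇒irreducible m-prime p∣m
... | inj₁ p≡1 = contradiction (subst Prime p≡1 p-prime) ¬prime[1]
... | inj₂ p≡m = p≡m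

prime⇒¬^2∣prime : Prime p → Prime m → ¬ (p ^ 2 ∣ m)
prime⇒¬^2∣prime {p} {m} p-prime m-prime p²∣m = <⇒≱ m<m² (∣⇒≤ m²∣m)
  where
  instance
    _ = prime⇒nonZero m-prime
  p≡m : p ≡ m
  p≡m = prime∣prime⇒≡ p-prime m-prime (∣-trans (m∣m*n (p * 1)) p²∣m)
  m²∣m : m * (m * 1) ∣ m
  m²∣m = subst (λ x → x * (x * 1) ∣ m) p≡m p²∣m
  m<m² : m < m * (m * 1)
  m<m² = m<m*n m (m * 1) (subst (1 <_) (sym (*-identityʳ m)) (ℕ.nonTrivial⇒n>1 m {{prime⇒nonTrivial m-prime}}))

prime⇒¬^2∣4 : Prime p → p ≢ 2 → ¬ (p ^ 2 ∣ 4)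
prime⇒¬^2∣4 {p} p-prime p≢2 p²∣4 with euclidsLemma 2 2 p-prime (∣-trans (m∣m*n (p * 1)) p²∣4)
... | inj₁ p∣2 = p≢2 (prime∣prime⇒≡ p-prime prime[2] p∣2)
... | inj₂ p∣2 = p≢2 (prime∣prime⇒≡ p-prime prime[2] p∣2)

suc∣ff : ∀ m → ¬ Prime (suc k) → suc k ≢ 4 → suc k ∣ ff m k
suc∣ff {k} m k+1-¬prime k+1≢4 = ∣-trans (¬prime⇒∣! k+1-¬prime k+1≢4) (!∣ff m k)

ff3/4-valGe-1 : ∀ m → Prime p → ValGe p (ff m 3) 4 -[1+ 0 ]
ff3/4-valGe-1 {p} m p-prime with p ≟ 2
... | yes refl = ∣*⇒valGe-1 (*-monoʳ-∣ 2 (∣-trans (∣! {2} {3} z<s (s≤s (s≤s z≤n))) (!∣ff m 3)))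
... | no  p≢2  = ¬^2∣⇒valGe-1 (prime⇒¬^2∣4 p-prime p≢2)

ff/suc-valGe-1 : ∀ m k → Prime p → ValGe p (ff m k) (suc k) -[1+ 0 ]
ff/suc-valGe-1 {p} m k p-prime with suc k ≟ 4 | prime? (suc k)
... | yes refl | _             = ff3/4-valGe-1 m p-prime
... | no _     | yes k+1-prime = ¬^2∣⇒valGe-1 (prime⇒¬^2∣prime p-prime k+1-prime)
... | no k+1≢4 | no k+1-¬prime =
  ∣*⇒valGe-1 {{prime⇒nonZero p-prime}} (∣n⇒∣m*n p (suc∣ff m k+1-¬prime k+1≢4))

∣⇒/≡ : suc k ∣ a → ∃[ z ] ((+ a) / suc k ≡ z / 1)
∣⇒/≡ {k} {a} (divides q a≡q*[k+1]) =
  + q , ℚ.fromℚᵘ-cong {ℚᵘ.mkℚᵘ (+ a) k} {ℚᵘ.mkℚᵘ (+ q) 0} (ℚᵘ.*≡* cross)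
  where
  cross : + a ℤ.* + 1 ≡ + q ℤ.* + suc k
  cross = trans (ℤ.*-identityʳ (+ a)) (trans (cong +_ a≡q*[k+1]) (ℤ.pos-* q (suc k)))

corollary1 : (k n : ℕ) → 1 ≤ k → 1 ≤ n →
    ((¬ (suc k ≡ 4 × 4 ∣ n)) → (¬ (Prime (suc k) × suc k ∣ n)) →
      ∃[ z ] ((+ ff (n ∸ 1) k) / suc k ≡ z / 1))
    × ((p : ℕ) → Prime p → ValGe p (ff (n ∸ 1) k) (suc k) -[1+ 0 ])
    × ((p : ℕ) → Prime p → ¬ (suc k ∣ n) → ValGe p (ff (n ∸ 1) k) (suc k) (+ 0))
corollary1 k n _ _ =
  integral , (λ _ → ff/suc-valGe-1 (n ∸ 1) k) , λ _ _ k+1∤n → ∣⇒valGe0 (suc∣ff-pred n k+1∤n)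
  where
  integral : ¬ (suc k ≡ 4 × 4 ∣ n) → ¬ (Prime (suc k) × suc k ∣ n) →
             ∃[ z ] ((+ ff (n ∸ 1) k) / suc k ≡ z / 1)
  integral not-4 not-prime with suc k ∣? n
  ... | no  k+1∤n = ∣⇒/≡ (suc∣ff-pred n k+1∤n)
  ... | yes k+1∣n = ∣⇒/≡ (suc∣ff (n ∸ 1) (λ k+1-prime → not-prime (k+1-prime , k+1∣n))
                                          (λ k+1≡4 → not-4 (k+1≡4 , subst (_∣ n) k+1≡4 k+1∣n)))
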